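{- For every integer $n\geq 14$, the $3$-uniform hypergraph $G_n$ described below is $C_3^{(3)}$-saturated. Consequently, $\mathrm{sat}_3(n,C_3^{(3)})\leq \frac{3}{2}n+O(1)$. Construction of $G_n$: write $n=4m+c$ with integers $m$ and $2\leq c\leq 5$. There are two common vertices $x,y$. For each $1\leq i\leq m+2-c$ let $A_i$ be the $3$-uniform hypergraph with vertex set $\{x,y,a_{x,i},a_{y,i},a_{1,i},a_{2,i}\}$ and edges $\{x,a_{x,i},a_{y,i}\}$, $\{y,a_{x,i},a_{y,i}\}$, $\{x,a_{x,i},a_{1,i}\}$, $\{x,a_{x,i},a_{2,i}\}$, $\{y,a_{y,i},a_{1,i}\}$, $\{y,a_{y,i},a_{2,i}\}$. For each $1\leq i\leq c-2$ let $B_i$ be the $3$-uniform hypergraph with vertex set $\{x,y,b_{x,i},b_{y,i},b_{1,i},b_{2,i},b_{3,i}\}$ and edges $\{x,b_{x,i},b_{y,i}\}$, $\{y,b_{x,i},b_{y,i}\}$, $\{b_{1,i},b_{2,i},b_{3,i}\}$, and $\{x,b_{x,i},b_{j,i}\}$, $\{y,b_{y,i},b_{j,i}\}$ for $j=1,2,3$. All the vertices other than $x,y$ are distinct across different $A_i$'s and $B_i$'s, and $G_n$ is the union of all the $A_i$ and $B_i$ (so $G_n$ has exactly $n$ vertices).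
   Context: The $3$-uniform loose cycle $C_3^{(3)}$ is the $3$-uniform hypergraph on $6$ vertices $v_1,\dots,v_6$ with edges $\{v_1,v_2,v_3\}$, $\{v_3,v_4,v_5\}$, $\{v_5,v_6,v_1\}$. A $3$-uniform hypergraph $H$ is $C_3^{(3)}$-saturated if it contains no copy of $C_3^{(3)}$ but $H+e$ contains one for every $3$-set $e\notin E(H)$ of vertices of $H$. $\mathrm{sat}_3(n,C_3^{(3)})$ is the minimum number of edges of a $C_3^{(3)}$-saturated $3$-uniform hypergraph on $n$ vertices. -}

module Defs where

open import Data.Nat using (ℕ; zero; suc; _+_; _*_; _∸_; _<_; _≤_)
open import Data.Nat.DivMod using (_/_; _%_)
open import Data.Product using (_×_; _,_; Σ; ∃-syntax)
open import Data.List using (List; []; _∷_; _++_; concatMap; upTo; length)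
open import Data.List.Relation.Unary.Any using (Any)
open import Data.List.Relation.Unary.All using (All)
open import Data.List.Relation.Unary.AllPairs using (AllPairs)
open import Data.List.Relation.Binary.Permutation.Propositional using (_↭_)
open import Relation.Binary.PropositionalEquality using (_≢_)
open import Relation.Nullary using (¬_)

-- Vertices are natural numbers; a 3-uniform hypergraph "on n vertices"
-- has vertex set {0, …, n-1}.  A (candidate) 3-set is written as a triple.
Triple : Set
Triple = ℕ × ℕ × ℕ

elems : Triple → List ℕ
elems (a , b , c) = a ∷ b ∷ c ∷ []

Distinct3 : Triple → Set
Distinct3 (a , b , c) = a ≢ b × a ≢ c × b ≢ c

Hypergraph : Set
Hypergraph = List Triple

_∈E_ : Triple → Hypergraph → Set
t ∈E H = Any (λ e → elems e ↭ elems t) H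

-- well-formed 3-uniform hypergraph on vertex set {0,…,n-1}:
-- every edge consists of 3 distinct vertices < n, and no 3-set is listed twice
-- (so length H is the number of edges).
IsHypergraph : ℕ → Hypergraph → Set
IsHypergraph n H =
  All (λ e → Distinct3 e × All (_< n) (elems e)) H ×
  AllPairs (λ e f → ¬ (elems e ↭ elems f)) H

ContainsC3 : Hypergraph → Set
ContainsC3 H =
  ∃[ v₁ ] ∃[ v₂ ] ∃[ v₃ ] ∃[ v₄ ] ∃[ v₅ ] ∃[ v₆ ]
    ( AllPairs _≢_ (v₁ ∷ v₂ ∷ v₃ ∷ v₄ ∷ v₅ ∷ v₆ ∷ [])
    × (v₁ , v₂ , v₃) ∈E H
    × (v₃ , v₄ , v₅) ∈E H
    × (v₅ , v₆ , v₁) ∈E H )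

Saturated : ℕ → Hypergraph → Set
Saturated n H =
  IsHypergraph n H ×
  ¬ ContainsC3 H ×
  (∀ (t : Triple) → Distinct3 t → All (_< n) (elems t) → ¬ (t ∈E H) →
     ContainsC3 (t ∷ H))

-- sat₃(n, C₃⁽³⁾) ≤ k   (sat is a minimum over saturated hypergraphs)
SatAtMost : ℕ → ℕ → Set
SatAtMost n k = Σ Hypergraph λ H → Saturated n H × length H ≤ k

-- The construction G_n.
-- n = 4m + c with 2 ≤ c ≤ 5:  m = (n-2) div 4, c = 2 + (n-2) mod 4.
-- x = 0, y = 1.  Number of A-blocks p = m+2-c, of B-blocks q = c-2.
-- A_i (i = 0,…,p-1) uses vertices 2+4i+k: a_x, a_y, a_1, a_2 (k = 0..3).
-- B_i (i = 0,…,q-1) uses vertices 2+4p+5i+k: b_x, b_y, b_1, b_2, b_3.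

mOf : ℕ → ℕ
mOf n = (n ∸ 2) / 4

cOf : ℕ → ℕ
cOf n = 2 + (n ∸ 2) % 4

pOf : ℕ → ℕ
pOf n = mOf n + 2 ∸ cOf n

qOf : ℕ → ℕ
qOf n = cOf n ∸ 2

vx vy : ℕ
vx = 0
vy = 1

blockA : ℕ → Hypergraph
blockA i =
  (vx , ax , ay) ∷ (vy , ax , ay) ∷
  (vx , ax , a₁) ∷ (vx , ax , a₂) ∷
  (vy , ay , a₁) ∷ (vy , ay , a₂) ∷ []
  where
  base = 2 + 4 * i
  ax = base
  ay = base + 1
  a₁ = base + 2
  a₂ = base + 3

blockB : ℕ → ℕ → Hypergraph
blockB p i =
  (vx , bx , by) ∷ (vy , bx , by) ∷ (b₁ , b₂ , b₃) ∷
  (vx , bx , b₁) ∷ (vx , bx , b₂) ∷ (vx , bx , b₃) ∷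
  (vy , by , b₁) ∷ (vy , by , b₂) ∷ (vy , by , b₃) ∷ []
  where
  base = 2 + 4 * p + 5 * i
  bx = base
  by = base + 1
  b₁ = base + 2
  b₂ = base + 3
  b₃ = base + 4

G : ℕ → Hypergraph
G n = concatMap blockA (upTo (pOf n)) ++ concatMap (blockB (pOf n)) (upTo (qOf n))

{-# OPTIONS --safe #-}
module Submission where

-- Every edge of G_n lies in a single block A_i or B_j together with the common vertices x and y.  So a
-- loose triangle lives in at most three blocks and a 3-set meets at most three blocks, and both C₃-freeness
-- and saturation reduce to sub-hypergraphs consisting of three blocks (n ≥ 14 provides three).  Blocks of
-- the same type are interchangeable, so each of these is a relabelling of one of the four hypergraphs
-- AAA, AAB, ABB, BBB, which are checked by evaluating a decision procedure.  For the count, n = 2 + 4p + 5q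
-- with q ≤ 3 B-blocks, and G_n has 6p + 9q = (3/2)(n − 2) + (3/2)q ≤ (3/2)n + 3/2 edges.

open import Defs
open import Data.Bool using (Bool; true; false; T; _∧_; _∨_)
open import Data.Bool.ListAction using (any; all)
open import Data.Bool.Properties using (T-∧; T-∨; T-≡)
open import Data.Empty using (⊥)
open import Data.Fin using (Fin; zero; suc; toℕ)
import Data.Fin.Properties as Fin
open import Data.List using (List; []; _∷_; _++_; map; concatMap; upTo; allFin; length; filter)
open import Data.List.Membership.Propositional using (_∈_; _∉_; find; lose)
open import Data.List.Membership.Propositional.Properties
  using (∈-map⁺; ∈-map⁻; ∈-++⁺ˡ; ∈-++⁺ʳ; ∈-++⁻; ∈-concatMap⁺; ∈-concatMap⁻; ∈-upTo⁺; ∈-upTo⁻; ∈-allFin;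
         ∈-filter⁺; ∈-filter⁻)
open import Data.List.Membership.DecPropositional using () renaming (_∈?_ to member?)
open import Data.List.Properties
  using (length-++; length-map; length-upTo; filter-notAll; map-concatMap; concatMap-map; concatMap-++;
         concatMap-cong)
open import Data.List.Relation.Binary.Permutation.Propositional using (_↭_; ↭-refl; ↭-sym; ↭-trans; prep; swap)
open import Data.List.Relation.Binary.Permutation.Propositional.Properties using (∈-resp-↭) renaming (map⁺ to ↭-map⁺)
open import Data.List.Relation.Binary.Subset.Propositional using (_⊆_)
open import Data.List.Relation.Binary.Subset.Propositional.Properties using (⊆∷∧∉⇒⊆; ∷⁺ʳ; concatMap⁺)
open import Data.List.Relation.Unary.All as All using (All; []; _∷_)
import Data.List.Relation.Unary.All.Properties as Allₚ
open import Data.List.Relation.Unary.Any as Any using (Any; here; there; any?)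
import Data.List.Relation.Unary.Any.Properties as Anyₚ
open import Data.List.Relation.Unary.AllPairs as AllPairs using (AllPairs; []; _∷_; allPairs?)
import Data.List.Relation.Unary.AllPairs.Properties as AllPairsₚ
open import Data.List.Relation.Unary.Unique.Propositional using (Unique)
import Data.List.Relation.Unary.Unique.Propositional.Properties as Unique
open import Data.Nat using (ℕ; zero; suc; _+_; _*_; _∸_; _≤_; _<_; _≮_; z≤n; s≤s; _<?_)
open import Data.Nat.DivMod
  using (_/_; _%_; _mod_; _divMod_; DivMod; m≡m%n+[m/n]*n; m%n<n; [m+kn]%n≡m%n; m<n⇒m%n≡m; m<n*o⇒m/o<n)
import Data.Nat.Properties as ℕ
open import Data.Nat.Tactic.RingSolver using (solve-∀)
open import Data.Product using (_×_; _,_; proj₁; proj₂; ∃-syntax)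
open import Data.Sum using (_⊎_; inj₁; inj₂)
import Data.Sum as Sum
import Data.Sum.Properties as Sum
open import Function using (id; _∘_)
open import Function.Bundles using (Equivalence)
open import Relation.Binary.Definitions using (DecidableEquality)
open import Relation.Binary.PropositionalEquality
  using (_≡_; _≢_; refl; sym; trans; cong; cong₂; subst; subst₂; module ≡-Reasoning)
open import Relation.Nullary using (Dec; yes; no; ¬_; ¬?; _×-dec_; contradiction)
open import Relation.Nullary.Decidable using (isYes; toWitness; fromWitness; from-yes)
import Relation.Nullary.Decidable as Dec
open Equivalence using (to; from)

private variable
  A B W W′ : Set

module _ (_≟_ : DecidableEquality A) where

  remove : A → List A → List A
  remove u = filter (λ v → ¬? (v ≟ u))

  remove-⊆ : ∀ {u S U} → S ⊆ u ∷ U → remove u S ⊆ U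
  remove-⊆ {u} S⊆uU v∈S′ with v∈S , v≢u ← ∈-filter⁻ (λ v → ¬? (v ≟ u)) v∈S′ with S⊆uU v∈S
  ... | here v≡u = contradiction v≡u v≢u
  ... | there v∈U = v∈U

  ⊆-remove : ∀ {u S T} → remove u S ⊆ T → S ⊆ u ∷ T
  ⊆-remove {u} S′⊆T {v} v∈S with v ≟ u
  ... | yes refl = here refl
  ... | no v≢u = there (S′⊆T (∈-filter⁺ (λ v → ¬? (v ≟ u)) v∈S v≢u))

  length-remove : ∀ {u S} → u ∈ S → length (remove u S) < length S
  length-remove {u} u∈S = filter-notAll (λ v → ¬? (v ≟ u)) _ (Any.map (λ u≡v v≢u → v≢u (sym u≡v)) u∈S)

  extend-to-size : ∀ k {S U : List A} → Unique U → S ⊆ U → length S ≤ k → k ≤ length U →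
                   ∃[ T ] Unique T × S ⊆ T × T ⊆ U × length T ≡ k
  extend-to-size zero {[]} _ _ _ _ = [] , [] , (λ ()) , (λ ()) , refl
  extend-to-size zero {_ ∷ _} _ _ () _
  extend-to-size (suc k) {U = []} _ _ _ ()
  extend-to-size (suc k) {S} {u ∷ U} (u∉U ∷ !U) S⊆uU |S|≤1+k 1+k≤|uU|
    with suc k ℕ.≟ length (u ∷ U) | any? (u ≟_) S
  ... | yes refl | _ = u ∷ U , u∉U ∷ !U , S⊆uU , id , refl
  ... | no 1+k≢ | no u∉S
    with T , !T , S⊆T , T⊆U , |T|≡1+k ←
           extend-to-size (suc k) !U (⊆∷∧∉⇒⊆ S⊆uU u∉S) |S|≤1+k (ℕ.≤-pred (ℕ.≤∧≢⇒< 1+k≤|uU| 1+k≢)) =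
    T , !T , S⊆T , there ∘ T⊆U , |T|≡1+k
  ... | no _ | yes u∈S
    with T , !T , S′⊆T , T⊆U , |T|≡k ←
           extend-to-size k !U (remove-⊆ S⊆uU) (ℕ.≤-pred (ℕ.<-≤-trans (length-remove u∈S) |S|≤1+k))
                          (ℕ.≤-pred 1+k≤|uU|) =
    u ∷ T , All.tabulate (All.lookup u∉U ∘ T⊆U) ∷ !T , ⊆-remove S′⊆T , ∷⁺ʳ u T⊆U , cong suc |T|≡k

lefts : List (A ⊎ B) → List A
lefts [] = []
lefts (inj₁ u ∷ xs) = u ∷ lefts xs
lefts (inj₂ _ ∷ xs) = lefts xs

rights : List (A ⊎ B) → List B
rights [] = []
rights (inj₁ _ ∷ xs) = rights xs
rights (inj₂ v ∷ xs) = v ∷ rights xs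

∈-lefts⁺ : ∀ {u : A} {xs : List (A ⊎ B)} → inj₁ u ∈ xs → u ∈ lefts xs
∈-lefts⁺ {xs = inj₁ _ ∷ _} (here refl) = here refl
∈-lefts⁺ {xs = inj₁ _ ∷ _} (there u∈) = there (∈-lefts⁺ u∈)
∈-lefts⁺ {xs = inj₂ _ ∷ _} (there u∈) = ∈-lefts⁺ u∈

∈-lefts⁻ : ∀ {u : A} {xs : List (A ⊎ B)} → u ∈ lefts xs → inj₁ u ∈ xs
∈-lefts⁻ {xs = inj₁ _ ∷ _} (here refl) = here refl
∈-lefts⁻ {xs = inj₁ _ ∷ _} (there u∈) = there (∈-lefts⁻ u∈)
∈-lefts⁻ {xs = inj₂ _ ∷ _} u∈ = there (∈-lefts⁻ u∈)

∈-rights⁺ : ∀ {v : B} {xs : List (A ⊎ B)} → inj₂ v ∈ xs → v ∈ rights xs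
∈-rights⁺ {xs = inj₂ _ ∷ _} (here refl) = here refl
∈-rights⁺ {xs = inj₂ _ ∷ _} (there v∈) = there (∈-rights⁺ v∈)
∈-rights⁺ {xs = inj₁ _ ∷ _} (there v∈) = ∈-rights⁺ v∈

∈-rights⁻ : ∀ {v : B} {xs : List (A ⊎ B)} → v ∈ rights xs → inj₂ v ∈ xs
∈-rights⁻ {xs = inj₂ _ ∷ _} (here refl) = here refl
∈-rights⁻ {xs = inj₂ _ ∷ _} (there v∈) = there (∈-rights⁻ v∈)
∈-rights⁻ {xs = inj₁ _ ∷ _} v∈ = there (∈-rights⁻ v∈)

lefts-unique : ∀ {xs : List (A ⊎ B)} → Unique xs → Unique (lefts xs)
lefts-unique {xs = []} [] = []
lefts-unique {xs = inj₁ u ∷ _} (u∉ ∷ !xs) =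
  All.tabulate (λ u′∈ u≡u′ → All.lookup u∉ (∈-lefts⁻ u′∈) (cong inj₁ u≡u′)) ∷ lefts-unique !xs
lefts-unique {xs = inj₂ _ ∷ _} (_ ∷ !xs) = lefts-unique !xs

rights-unique : ∀ {xs : List (A ⊎ B)} → Unique xs → Unique (rights xs)
rights-unique {xs = []} [] = []
rights-unique {xs = inj₂ v ∷ _} (v∉ ∷ !xs) =
  All.tabulate (λ v′∈ v≡v′ → All.lookup v∉ (∈-rights⁻ v′∈) (cong inj₂ v≡v′)) ∷ rights-unique !xs
rights-unique {xs = inj₁ _ ∷ _} (_ ∷ !xs) = rights-unique !xs

length-lefts+rights : ∀ (xs : List (A ⊎ B)) → length (lefts xs) + length (rights xs) ≡ length xs
length-lefts+rights [] = refl
length-lefts+rights (inj₁ _ ∷ xs) = cong suc (length-lefts+rights xs)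
length-lefts+rights (inj₂ _ ∷ xs) = trans (ℕ.+-suc _ _) (cong suc (length-lefts+rights xs))

nth : List ℕ → ℕ → ℕ
nth [] _ = 0
nth (i ∷ is) zero = i
nth (i ∷ is) (suc s) = nth is s

position : List ℕ → ℕ → ℕ
position [] _ = 0
position (i ∷ is) j with j ℕ.≟ i
... | yes _ = 0
... | no _ = suc (position is j)

nth-position : ∀ {is j} → j ∈ is → nth is (position is j) ≡ j
nth-position {i ∷ is} {j} j∈ with j ℕ.≟ i | j∈
... | yes j≡i | _ = sym j≡i
... | no j≢i | here j≡i = contradiction j≡i j≢i
... | no _ | there j∈is = nth-position j∈is

position< : ∀ {is j} → j ∈ is → position is j < length is
position< {i ∷ is} {j} j∈ with j ℕ.≟ i | j∈
... | yes _ | _ = s≤s z≤n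
... | no j≢i | here j≡i = contradiction j≡i j≢i
... | no _ | there j∈is = s≤s (position< j∈is)

∈-nth : ∀ {is s} → s < length is → nth is s ∈ is
∈-nth {i ∷ is} {zero} _ = here refl
∈-nth {i ∷ is} {suc s} (s≤s s<) = there (∈-nth s<)

position-nth : ∀ {is s} → Unique is → s < length is → position is (nth is s) ≡ s
position-nth {i ∷ is} {zero} _ _ with i ℕ.≟ i
... | yes _ = refl
... | no i≢i = contradiction refl i≢i
position-nth {i ∷ is} {suc s} (i∉ ∷ !is) (s≤s s<) with nth is s ℕ.≟ i
... | yes is[s]≡i = contradiction (sym is[s]≡i) (All.lookup i∉ (∈-nth s<))
... | no _ = cong suc (position-nth !is s<)

concatMap-sources : (f : A → List B) {U : List A} {E : List B} → E ⊆ concatMap f U →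
                    ∃[ S ] S ⊆ U × length S ≡ length E × E ⊆ concatMap f S
concatMap-sources f {E = []} _ = [] , (λ ()) , refl , (λ ())
concatMap-sources f {U} {E = e ∷ E} eE⊆
  with u , u∈U , e∈fu ← find (∈-concatMap⁻ f (eE⊆ (here refl)))
  with S , S⊆U , |S|≡|E| , E⊆ ← concatMap-sources f (eE⊆ ∘ there) =
  u ∷ S , uS⊆U , cong suc |S|≡|E| , eE⊆′
  where
  uS⊆U : u ∷ S ⊆ U
  uS⊆U (here refl) = u∈U
  uS⊆U (there w∈S) = S⊆U w∈S
  eE⊆′ : e ∷ E ⊆ concatMap f (u ∷ S)
  eE⊆′ (here refl) = ∈-++⁺ˡ e∈fu
  eE⊆′ (there e′∈E) = ∈-++⁺ʳ (f u) (E⊆ e′∈E)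

length-concatMap≤ : (f : A → List B) → (∀ u → length (f u) ≤ 1) → ∀ us → length (concatMap f us) ≤ length us
length-concatMap≤ f |f|≤1 [] = z≤n
length-concatMap≤ f |f|≤1 (u ∷ us) =
  ℕ.≤-trans (ℕ.≤-reflexive (length-++ (f u))) (ℕ.+-mono-≤ (|f|≤1 u) (length-concatMap≤ f |f|≤1 us))

length-concatMap : (f : A → List B) {c : ℕ} → (∀ u → length (f u) ≡ c) → ∀ us →
                   length (concatMap f us) ≡ length us * c
length-concatMap f |f|≡c [] = refl
length-concatMap f |f|≡c (u ∷ us) = trans (length-++ (f u)) (cong₂ _+_ (|f|≡c u) (length-concatMap f |f|≡c us))

AllPairs-map : {P : W → Set} {R : W → W → Set} {R′ : W′ → W′ → Set} (f : W → W′) →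
               (∀ {u v} → P u → P v → R u v → R′ (f u) (f v)) →
               {vs : List W} → All P vs → AllPairs R vs → AllPairs R′ (map f vs)
AllPairs-map f R⇒R′ [] [] = []
AllPairs-map f R⇒R′ (pu ∷ pvs) (Ru ∷ Rvs) =
  Allₚ.map⁺ (All.zipWith (λ (pv , Ruv) → R⇒R′ pu pv Ruv) (pvs , Ru)) ∷ AllPairs-map f R⇒R′ pvs Rvs

InjectiveOn : (W → Set) → (W → W′) → Set
InjectiveOn P f = ∀ {u v} → P u → P v → f u ≡ f v → u ≡ v

LeftInverseOn : (W → Set) → (W → W′) → (W′ → W) → Set
LeftInverseOn P f g = ∀ {v} → P v → g (f v) ≡ v

LeftInverseOn⇒InjectiveOn : {P : W → Set} {f : W → W′} {g : W′ → W} → LeftInverseOn P f g → InjectiveOn P f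
LeftInverseOn⇒InjectiveOn {g = g} g∘f≡id pu pv fu≡fv = trans (sym (g∘f≡id pu)) (trans (cong g fu≡fv) (g∘f≡id pv))

Tri : Set → Set
Tri W = W × W × W

el : Tri W → List W
el (u , v , w) = u ∷ v ∷ w ∷ []

map₃ : (W → W′) → Tri W → Tri W′
map₃ f (u , v , w) = f u , f v , f w

Distinct : Tri W → Set
Distinct (u , v , w) = u ≢ v × u ≢ w × v ≢ w

_⊆ₜ_ : Tri W → Tri W → Set
t ⊆ₜ e = All (_∈ el e) (el t)

LiesIn : Tri W → List (Tri W) → Set
LiesIn t H = Any (t ⊆ₜ_) H

HasC3 : List (Tri W) → Set
HasC3 H = ∃[ v₁ ] ∃[ v₂ ] ∃[ v₃ ] ∃[ v₄ ] ∃[ v₅ ] ∃[ v₆ ]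
  ( AllPairs _≢_ (v₁ ∷ v₂ ∷ v₃ ∷ v₄ ∷ v₅ ∷ v₆ ∷ [])
  × LiesIn (v₁ , v₂ , v₃) H × LiesIn (v₃ , v₄ , v₅) H × LiesIn (v₅ , v₆ , v₁) H )

SaturatedOn : (W → Set) → List (Tri W) → Set
SaturatedOn P H = ∀ {t} → Distinct t → All P (el t) → ¬ LiesIn t H → HasC3 (t ∷ H)

⊆ₜ-refl : (t : Tri W) → t ⊆ₜ t
⊆ₜ-refl (u , v , w) = here refl ∷ there (here refl) ∷ there (there (here refl)) ∷ []

⊆ₜ-trans : {s t e : Tri W} → s ⊆ₜ t → t ⊆ₜ e → s ⊆ₜ e
⊆ₜ-trans s⊆t t⊆e = All.map (All.lookup t⊆e) s⊆t

↭⇒⊆ₜ : {t e : Tri W} → el e ↭ el t → t ⊆ₜ e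
↭⇒⊆ₜ e↭t = All.tabulate (∈-resp-↭ (↭-sym e↭t))

perms : Tri W → List (Tri W)
perms (u , v , w) = (u , v , w) ∷ (u , w , v) ∷ (v , u , w) ∷ (v , w , u) ∷ (w , u , v) ∷ (w , v , u) ∷ []

∈-perms⇒↭ : {t e : Tri W} → t ∈ perms e → el e ↭ el t
∈-perms⇒↭ (here refl) = ↭-refl
∈-perms⇒↭ (there (here refl)) = prep _ (swap _ _ ↭-refl)
∈-perms⇒↭ (there (there (here refl))) = swap _ _ ↭-refl
∈-perms⇒↭ (there (there (there (here refl)))) = ↭-trans (swap _ _ ↭-refl) (prep _ (swap _ _ ↭-refl))
∈-perms⇒↭ (there (there (there (there (here refl))))) = ↭-trans (prep _ (swap _ _ ↭-refl)) (swap _ _ ↭-refl)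
∈-perms⇒↭ (there (there (there (there (there (here refl)))))) =
  ↭-trans (swap _ _ ↭-refl) (↭-trans (prep _ (swap _ _ ↭-refl)) (swap _ _ ↭-refl))

⊆ₜ⇒∈-perms : {t e : Tri W} → Distinct t → t ⊆ₜ e → t ∈ perms e
⊆ₜ⇒∈-perms _ (here refl ∷ there (here refl) ∷ there (there (here refl)) ∷ []) = here refl
⊆ₜ⇒∈-perms _ (here refl ∷ there (there (here refl)) ∷ there (here refl) ∷ []) =
  there (here refl)
⊆ₜ⇒∈-perms _ (there (here refl) ∷ here refl ∷ there (there (here refl)) ∷ []) =
  there (there (here refl))
⊆ₜ⇒∈-perms _ (there (here refl) ∷ there (there (here refl)) ∷ here refl ∷ []) =
  there (there (there (here refl)))
⊆ₜ⇒∈-perms _ (there (there (here refl)) ∷ here refl ∷ there (here refl) ∷ []) =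
  there (there (there (there (here refl))))
⊆ₜ⇒∈-perms _ (there (there (here refl)) ∷ there (here refl) ∷ here refl ∷ []) =
  there (there (there (there (there (here refl)))))
⊆ₜ⇒∈-perms (u≢v , _ , _) (here refl ∷ here refl ∷ _) = contradiction refl u≢v
⊆ₜ⇒∈-perms (u≢v , _ , _) (there (here refl) ∷ there (here refl) ∷ _) = contradiction refl u≢v
⊆ₜ⇒∈-perms (u≢v , _ , _) (there (there (here refl)) ∷ there (there (here refl)) ∷ _) = contradiction refl u≢v
⊆ₜ⇒∈-perms (_ , u≢w , _) (here refl ∷ _ ∷ here refl ∷ []) = contradiction refl u≢w
⊆ₜ⇒∈-perms (_ , u≢w , _) (there (here refl) ∷ _ ∷ there (here refl) ∷ []) = contradiction refl u≢w
⊆ₜ⇒∈-perms (_ , u≢w , _) (there (there (here refl)) ∷ _ ∷ there (there (here refl)) ∷ []) = contradiction refl u≢w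
⊆ₜ⇒∈-perms (_ , _ , v≢w) (_ ∷ here refl ∷ here refl ∷ []) = contradiction refl v≢w
⊆ₜ⇒∈-perms (_ , _ , v≢w) (_ ∷ there (here refl) ∷ there (here refl) ∷ []) = contradiction refl v≢w
⊆ₜ⇒∈-perms (_ , _ , v≢w) (_ ∷ there (there (here refl)) ∷ there (there (here refl)) ∷ []) = contradiction refl v≢w

≢-sides : {v₁ v₂ v₃ v₄ v₅ v₆ : W} → AllPairs _≢_ (v₁ ∷ v₂ ∷ v₃ ∷ v₄ ∷ v₅ ∷ v₆ ∷ []) →
          Distinct (v₁ , v₂ , v₃) × Distinct (v₃ , v₄ , v₅) × Distinct (v₅ , v₆ , v₁)
≢-sides ((v₁≢v₂ ∷ v₁≢v₃ ∷ _ ∷ v₁≢v₅ ∷ v₁≢v₆ ∷ []) ∷ (v₂≢v₃ ∷ _) ∷ (v₃≢v₄ ∷ v₃≢v₅ ∷ _) ∷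
        (v₄≢v₅ ∷ _) ∷ (v₅≢v₆ ∷ []) ∷ [] ∷ []) =
  (v₁≢v₂ , v₁≢v₃ , v₂≢v₃) , (v₃≢v₄ , v₃≢v₅ , v₄≢v₅) , (v₅≢v₆ , v₁≢v₅ ∘ sym , v₁≢v₆ ∘ sym)

_≼_ : List (Tri W) → List (Tri W) → Set
H ≼ H′ = ∀ {e} → e ∈ H → LiesIn e H′

⊆⇒≼ : {H H′ : List (Tri W)} → H ⊆ H′ → H ≼ H′
⊆⇒≼ H⊆H′ e∈H = lose (H⊆H′ e∈H) (⊆ₜ-refl _)

∷-≼ : {t t′ : Tri W} {H : List (Tri W)} → t ⊆ₜ t′ → (t ∷ H) ≼ (t′ ∷ H)
∷-≼ t⊆t′ (here refl) = here t⊆t′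
∷-≼ _ (there e∈H) = there (lose e∈H (⊆ₜ-refl _))

LiesIn-≼ : {t : Tri W} {H H′ : List (Tri W)} → H ≼ H′ → LiesIn t H → LiesIn t H′
LiesIn-≼ H≼H′ t∈H with _ , e∈H , t⊆e ← find t∈H = Any.map (⊆ₜ-trans t⊆e) (H≼H′ e∈H)

HasC3-≼ : {H H′ : List (Tri W)} → H ≼ H′ → HasC3 H → HasC3 H′
HasC3-≼ H≼H′ (v₁ , v₂ , v₃ , v₄ , v₅ , v₆ , d , s₁ , s₂ , s₃) =
  v₁ , v₂ , v₃ , v₄ , v₅ , v₆ , d , LiesIn-≼ H≼H′ s₁ , LiesIn-≼ H≼H′ s₂ , LiesIn-≼ H≼H′ s₃

HasC3-⊆ : {H H′ : List (Tri W)} → H ⊆ H′ → HasC3 H → HasC3 H′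
HasC3-⊆ = HasC3-≼ ∘ ⊆⇒≼

HasC3-edges : {H : List (Tri W)} → HasC3 H → ∃[ E ] E ⊆ H × length E ≡ 3 × HasC3 E
HasC3-edges {H = H} (v₁ , v₂ , v₃ , v₄ , v₅ , v₆ , d , s₁ , s₂ , s₃)
  with e₁ , e₁∈ , t₁⊆e₁ ← find s₁ | e₂ , e₂∈ , t₂⊆e₂ ← find s₂ | e₃ , e₃∈ , t₃⊆e₃ ← find s₃ =
  e₁ ∷ e₂ ∷ e₃ ∷ [] , E⊆H , refl ,
  (v₁ , v₂ , v₃ , v₄ , v₅ , v₆ , d , here t₁⊆e₁ , there (here t₂⊆e₂) , there (there (here t₃⊆e₃)))
  where
  E⊆H : e₁ ∷ e₂ ∷ e₃ ∷ [] ⊆ H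
  E⊆H (here refl) = e₁∈
  E⊆H (there (here refl)) = e₂∈
  E⊆H (there (there (here refl))) = e₃∈

map₃-inverse : {P : W → Set} {f : W → W′} {g : W′ → W} {t : Tri W} →
               LeftInverseOn P f g → All P (el t) → map₃ g (map₃ f t) ≡ t
map₃-inverse g∘f≡id (pu ∷ pv ∷ pw ∷ []) = cong₂ _,_ (g∘f≡id pu) (cong₂ _,_ (g∘f≡id pv) (g∘f≡id pw))

All-el-map₃ : {P : W → Set} {Q : W′ → Set} (f : W → W′) {t : Tri W} →
              (∀ {v} → P v → Q (f v)) → All P (el t) → All Q (el (map₃ f t))
All-el-map₃ f {_ , _ , _} P⇒Q (pu ∷ pv ∷ pw ∷ []) = P⇒Q pu ∷ P⇒Q pv ∷ P⇒Q pw ∷ []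

Distinct-map : {P : W → Set} {f : W → W′} {t : Tri W} →
               InjectiveOn P f → All P (el t) → Distinct t → Distinct (map₃ f t)
Distinct-map f-inj (pu ∷ pv ∷ pw ∷ []) (u≢v , u≢w , v≢w) =
  u≢v ∘ f-inj pu pv , u≢w ∘ f-inj pu pw , v≢w ∘ f-inj pv pw

Distinct-map⁻ : (f : W → W′) {t : Tri W} → Distinct (map₃ f t) → Distinct t
Distinct-map⁻ f (fu≢fv , fu≢fw , fv≢fw) = fu≢fv ∘ cong f , fu≢fw ∘ cong f , fv≢fw ∘ cong f

⊆ₜ-map : (f : W → W′) {t e : Tri W} → t ⊆ₜ e → map₃ f t ⊆ₜ map₃ f e
⊆ₜ-map f {e = _ , _ , _} (u∈e ∷ v∈e ∷ w∈e ∷ []) = ∈-map⁺ f u∈e ∷ ∈-map⁺ f v∈e ∷ ∈-map⁺ f w∈e ∷ []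

LiesIn-map : (f : W → W′) {t : Tri W} {H : List (Tri W)} {H′ : List (Tri W′)} →
             (∀ {e} → e ∈ H → map₃ f e ∈ H′) → LiesIn t H → LiesIn (map₃ f t) H′
LiesIn-map f f[H]⊆H′ t∈H with _ , e∈H , t⊆e ← find t∈H = lose (f[H]⊆H′ e∈H) (⊆ₜ-map f t⊆e)

LiesIn-vertices : {P : W → Set} {t : Tri W} {H : List (Tri W)} →
                  (∀ {e} → e ∈ H → All P (el e)) → LiesIn t H → All P (el t)
LiesIn-vertices H⊆P t∈H with _ , e∈H , t⊆e ← find t∈H = All.map (All.lookup (H⊆P e∈H)) t⊆e

HasC3-map : (f : W → W′) {P : W → Set} {H : List (Tri W)} {H′ : List (Tri W′)} →
            (∀ {e} → e ∈ H → All P (el e)) → InjectiveOn P f → (∀ {e} → e ∈ H → map₃ f e ∈ H′) →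
            HasC3 H → HasC3 H′
HasC3-map f H⊆P f-inj f[H]⊆H′ (v₁ , v₂ , v₃ , v₄ , v₅ , v₆ , d , s₁ , s₂ , s₃)
  with p₁ ∷ p₂ ∷ p₃ ∷ [] ← LiesIn-vertices H⊆P s₁
  with _ ∷ p₄ ∷ p₅ ∷ [] ← LiesIn-vertices H⊆P s₂
  with _ ∷ p₆ ∷ _ ∷ [] ← LiesIn-vertices H⊆P s₃ =
  f v₁ , f v₂ , f v₃ , f v₄ , f v₅ , f v₆ ,
  AllPairs-map f (λ pu pv u≢v → u≢v ∘ f-inj pu pv) (p₁ ∷ p₂ ∷ p₃ ∷ p₄ ∷ p₅ ∷ p₆ ∷ []) d ,
  LiesIn-map f f[H]⊆H′ s₁ , LiesIn-map f f[H]⊆H′ s₂ , LiesIn-map f f[H]⊆H′ s₃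

HasC3-pull : (f : W → W′) (g : W′ → W) {P : W → Set} {H : List (Tri W)} {H′ : List (Tri W′)} →
             LeftInverseOn P f g → (∀ {e} → e ∈ H → All P (el e)) →
             (∀ {e′} → e′ ∈ H′ → ∃[ e ] e ∈ H × map₃ f e ≡ e′) → HasC3 H′ → HasC3 H
HasC3-pull {W′ = W′} f g {P} {H} {H′} g∘f≡id H⊆P H′⊆f[H] = HasC3-map g H′⊆f[P] g-inj g[H′]⊆H
  where
  f[P] : W′ → Set
  f[P] w = ∃[ v ] P v × f v ≡ w

  H′⊆f[P] : ∀ {e′} → e′ ∈ H′ → All f[P] (el e′)
  H′⊆f[P] e′∈H′ with (_ , _ , _) , e∈H , refl ← H′⊆f[H] e′∈H′
    with pu ∷ pv ∷ pw ∷ [] ← H⊆P e∈H = (_ , pu , refl) ∷ (_ , pv , refl) ∷ (_ , pw , refl) ∷ []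

  g-inj : InjectiveOn f[P] g
  g-inj (_ , pu , refl) (_ , pv , refl) gfu≡gfv = cong f (trans (sym (g∘f≡id pu)) (trans gfu≡gfv (g∘f≡id pv)))

  g[H′]⊆H : ∀ {e′} → e′ ∈ H′ → map₃ g e′ ∈ H
  g[H′]⊆H e′∈H′ with e , e∈H , refl ← H′⊆f[H] e′∈H′ =
    subst (_∈ H) (sym (map₃-inverse {f = f} {g = g} g∘f≡id (H⊆P e∈H))) e∈H

SaturatedOn-transfer : (f : W → W′) (g : W′ → W) {P : W → Set} {P′ : W′ → Set}
                       {H : List (Tri W)} {H′ : List (Tri W′)} →
                       LeftInverseOn P f g → LeftInverseOn P′ g f → (∀ {v} → P′ v → P (g v)) →
                       (∀ {e} → e ∈ H → All P (el e)) → (∀ {e} → e ∈ H → map₃ f e ∈ H′) →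
                       SaturatedOn P H → SaturatedOn P′ H′
SaturatedOn-transfer f g {P} {P′} {H} {H′} g∘f≡id f∘g≡id P′⇒P H⊆P f[H]⊆H′ saturated {t} d t⊆P′ t∉H′ =
  subst (λ t′ → HasC3 (t′ ∷ H′)) f[t₀]≡t
    (HasC3-map f vertices (LeftInverseOn⇒InjectiveOn {g = g} g∘f≡id) edges
      (saturated (Distinct-map⁻ f (subst Distinct (sym f[t₀]≡t) d)) t₀⊆P
                 (t∉H′ ∘ subst (λ t′ → LiesIn t′ H′) f[t₀]≡t ∘ LiesIn-map f f[H]⊆H′)))
  where
  t₀ : Tri _
  t₀ = map₃ g t
  f[t₀]≡t : map₃ f t₀ ≡ t
  f[t₀]≡t = map₃-inverse {f = g} {g = f} f∘g≡id t⊆P′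
  t₀⊆P : All P (el t₀)
  t₀⊆P = All-el-map₃ g P′⇒P t⊆P′
  vertices : ∀ {e} → e ∈ t₀ ∷ H → All P (el e)
  vertices (here refl) = t₀⊆P
  vertices (there e∈H) = H⊆P e∈H
  edges : ∀ {e} → e ∈ t₀ ∷ H → map₃ f e ∈ map₃ f t₀ ∷ H′
  edges (here refl) = here refl
  edges (there e∈H) = there (f[H]⊆H′ e∈H)

-- Deciding loose triangles and saturation

-- The searches are Boolean rather than built from any?, because the type checker runs them on the
-- three-block hypergraphs, and Boolean evaluation is several times faster.
module Search (_≟_ : DecidableEquality W) where

  orderings : List (Tri W) → List (Tri W)
  orderings = concatMap perms

  ∈-orderings⁺ : {t : Tri W} {H : List (Tri W)} → Distinct t → LiesIn t H → t ∈ orderings H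
  ∈-orderings⁺ d t∈H with _ , e∈H , t⊆e ← find t∈H = ∈-concatMap⁺ perms (lose e∈H (⊆ₜ⇒∈-perms d t⊆e))

  ∈-orderings⁻ : {t : Tri W} {H : List (Tri W)} → t ∈ orderings H → LiesIn t H
  ∈-orderings⁻ t∈ with _ , e∈H , t∈perms ← find (∈-concatMap⁻ perms t∈) = lose e∈H (↭⇒⊆ₜ (∈-perms⇒↭ t∈perms))

  Linked : Tri W → Tri W → Set
  Linked (_ , _ , v₃) (v₃′ , _ , _) = v₃′ ≡ v₃

  linked? : ∀ t₁ t₂ → Dec (Linked t₁ t₂)
  linked? (_ , _ , v₃) (v₃′ , _ , _) = v₃′ ≟ v₃

  Closes : Tri W → Tri W → Tri W → Set
  Closes (v₁ , v₂ , v₃) (_ , v₄ , v₅) (v₅′ , v₆ , v₁′) =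
    v₅′ ≡ v₅ × v₁′ ≡ v₁ × AllPairs _≢_ (v₁ ∷ v₂ ∷ v₃ ∷ v₄ ∷ v₅ ∷ v₆ ∷ [])

  closes? : ∀ t₁ t₂ t₃ → Dec (Closes t₁ t₂ t₃)
  closes? (v₁ , v₂ , v₃) (_ , v₄ , v₅) (v₅′ , v₆ , v₁′) =
    v₅′ ≟ v₅ ×-dec v₁′ ≟ v₁ ×-dec allPairs? (λ u v → ¬? (u ≟ v)) _

  c3Search : List (Tri W) → Bool
  c3Search H = any (λ t₁ → any (continues t₁) os) os
    where
    os : List (Tri W)
    os = orderings H
    continues : Tri W → Tri W → Bool
    continues t₁ t₂ = isYes (linked? t₁ t₂) ∧ any (isYes ∘ closes? t₁ t₂) os

  c3Search-sound : {H : List (Tri W)} → T (c3Search H) → HasC3 H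
  c3Search-sound {H} found
    with (v₁ , v₂ , v₃) , t₁∈ , found₁ ← find (Anyₚ.any⁻ _ (orderings H) found)
    with (v₃′ , v₄ , v₅) , t₂∈ , found₂ ← find (Anyₚ.any⁻ _ (orderings H) found₁)
    with linked , found₃ ← T-∧ .to found₂
    with (v₅′ , v₆ , v₁′) , t₃∈ , closes ← find (Anyₚ.any⁻ _ (orderings H) found₃)
    with refl ← toWitness {a? = linked? (v₁ , v₂ , v₃) (v₃′ , v₄ , v₅)} linked
    with refl , refl , d ← toWitness {a? = closes? (v₁ , v₂ , v₃) (v₃ , v₄ , v₅) (v₅′ , v₆ , v₁′)} closes =
    v₁ , v₂ , v₃ , v₄ , v₅ , v₆ , d , ∈-orderings⁻ t₁∈ , ∈-orderings⁻ t₂∈ , ∈-orderings⁻ t₃∈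

  c3Search-complete : {H : List (Tri W)} → HasC3 H → T (c3Search H)
  c3Search-complete (v₁ , v₂ , v₃ , v₄ , v₅ , v₆ , d , s₁ , s₂ , s₃) with d₁ , d₂ , d₃ ← ≢-sides d =
    Anyₚ.any⁺ _ (lose (∈-orderings⁺ d₁ s₁) (Anyₚ.any⁺ _ (lose (∈-orderings⁺ d₂ s₂)
      (T-∧ .from (fromWitness refl , Anyₚ.any⁺ _ (lose (∈-orderings⁺ d₃ s₃) (fromWitness (refl , refl , d))))))))

  liesIn? : ∀ t H → Dec (LiesIn t H)
  liesIn? t H = any? (λ e → All.all? (λ v → member? _≟_ v (el e)) (el t)) H

  pairsFrom : List W → List (W × W)
  pairsFrom [] = []
  pairsFrom (v ∷ vs) = map (v ,_) vs ++ pairsFrom vs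

  triplesFrom : List W → List (Tri W)
  triplesFrom [] = []
  triplesFrom (v ∷ vs) = map (v ,_) (pairsFrom vs) ++ triplesFrom vs

  ∈-pairsFrom : {u v : W} {vs : List W} → u ≢ v → u ∈ vs → v ∈ vs →
                (u , v) ∈ pairsFrom vs ⊎ (v , u) ∈ pairsFrom vs
  ∈-pairsFrom u≢v (here refl) (here refl) = contradiction refl u≢v
  ∈-pairsFrom u≢v (here refl) (there v∈) = inj₁ (∈-++⁺ˡ (∈-map⁺ _ v∈))
  ∈-pairsFrom u≢v (there u∈) (here refl) = inj₂ (∈-++⁺ˡ (∈-map⁺ _ u∈))
  ∈-pairsFrom {vs = w ∷ vs} u≢v (there u∈) (there v∈) =
    Sum.map (∈-++⁺ʳ (map (w ,_) vs)) (∈-++⁺ʳ (map (w ,_) vs)) (∈-pairsFrom u≢v u∈ v∈)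

  ∈-triplesFrom : {t : Tri W} {vs : List W} → Distinct t → All (_∈ vs) (el t) →
                  ∃[ t′ ] t′ ∈ triplesFrom vs × t′ ∈ perms t
  ∈-triplesFrom (u≢v , _ , _) (here refl ∷ here refl ∷ _) = contradiction refl u≢v
  ∈-triplesFrom (_ , u≢w , _) (here refl ∷ _ ∷ here refl ∷ []) = contradiction refl u≢w
  ∈-triplesFrom (_ , _ , v≢w) (_ ∷ here refl ∷ here refl ∷ []) = contradiction refl v≢w
  ∈-triplesFrom (_ , _ , v≢w) (here refl ∷ there v∈ ∷ there w∈ ∷ []) with ∈-pairsFrom v≢w v∈ w∈
  ... | inj₁ vw∈ = _ , ∈-++⁺ˡ (∈-map⁺ _ vw∈) , here refl
  ... | inj₂ wv∈ = _ , ∈-++⁺ˡ (∈-map⁺ _ wv∈) , there (here refl)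
  ∈-triplesFrom (_ , u≢w , _) (there u∈ ∷ here refl ∷ there w∈ ∷ []) with ∈-pairsFrom u≢w u∈ w∈
  ... | inj₁ uw∈ = _ , ∈-++⁺ˡ (∈-map⁺ _ uw∈) , there (there (here refl))
  ... | inj₂ wu∈ = _ , ∈-++⁺ˡ (∈-map⁺ _ wu∈) , there (there (there (here refl)))
  ∈-triplesFrom (u≢v , _ , _) (there u∈ ∷ there v∈ ∷ here refl ∷ []) with ∈-pairsFrom u≢v u∈ v∈
  ... | inj₁ uv∈ = _ , ∈-++⁺ˡ (∈-map⁺ _ uv∈) , there (there (there (there (here refl))))
  ... | inj₂ vu∈ = _ , ∈-++⁺ˡ (∈-map⁺ _ vu∈) , there (there (there (there (there (here refl)))))
  ∈-triplesFrom {vs = v ∷ vs} d (there u∈ ∷ there v∈ ∷ there w∈ ∷ [])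
    with t′ , t′∈ , t′∈perms ← ∈-triplesFrom d (u∈ ∷ v∈ ∷ w∈ ∷ []) =
    t′ , ∈-++⁺ʳ (map (v ,_) (pairsFrom vs)) t′∈ , t′∈perms

  saturated-by-triples : {vs : List W} {H : List (Tri W)} →
                         (∀ {t} → t ∈ triplesFrom vs → LiesIn t H ⊎ HasC3 (t ∷ H)) → SaturatedOn (_∈ vs) H
  saturated-by-triples triples-ok d t⊆vs t∉H with t′ , t′∈ , t′∈perms ← ∈-triplesFrom d t⊆vs
    with triples-ok t′∈
  ... | inj₁ t′∈H = contradiction (Any.map (⊆ₜ-trans (↭⇒⊆ₜ (↭-sym (∈-perms⇒↭ t′∈perms)))) t′∈H) t∉H
  ... | inj₂ c3 = HasC3-≼ (∷-≼ (↭⇒⊆ₜ (∈-perms⇒↭ t′∈perms))) c3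

  saturationCheck : List W → List (Tri W) → Bool
  saturationCheck vs H = all (λ t → isYes (liesIn? t H) ∨ c3Search (t ∷ H)) (triplesFrom vs)

  saturationCheck-sound : {vs : List W} {H : List (Tri W)} → T (saturationCheck vs H) → SaturatedOn (_∈ vs) H
  saturationCheck-sound {vs} {H} ok = saturated-by-triples λ {t} t∈ →
    Sum.map (toWitness {a? = liesIn? t H}) c3Search-sound
      (T-∨ {isYes (liesIn? t H)} {c3Search (t ∷ H)} .to
        (All.lookup (Allₚ.all⁺ (λ t → isYes (liesIn? t H) ∨ c3Search (t ∷ H)) (triplesFrom vs) ok) t∈))

-- The construction on abstract vertices

-- a i 0, a i 1, a i 2, a i 3 are a_{x,i+1}, a_{y,i+1}, a_{1,i+1}, a_{2,i+1}, and b j 0, …, b j 4 are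
-- b_{x,j+1}, b_{y,j+1}, b_{1,j+1}, b_{2,j+1}, b_{3,j+1}.  The block inj₁ i is A_{i+1}, inj₂ j is B_{j+1}.
data V : Set where
  x y : V
  a : ℕ → Fin 4 → V
  b : ℕ → Fin 5 → V

_≟ᵥ_ : DecidableEquality V
x ≟ᵥ x = yes refl
y ≟ᵥ y = yes refl
a i k ≟ᵥ a j l = Dec.map′ (λ (k≡l , i≡j) → cong₂ a i≡j k≡l) (λ { refl → refl , refl }) (k Fin.≟ l ×-dec i ℕ.≟ j)
b i k ≟ᵥ b j l = Dec.map′ (λ (k≡l , i≡j) → cong₂ b i≡j k≡l) (λ { refl → refl , refl }) (k Fin.≟ l ×-dec i ℕ.≟ j)
x ≟ᵥ y = no λ ()
x ≟ᵥ a _ _ = no λ ()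
x ≟ᵥ b _ _ = no λ ()
y ≟ᵥ x = no λ ()
y ≟ᵥ a _ _ = no λ ()
y ≟ᵥ b _ _ = no λ ()
a _ _ ≟ᵥ x = no λ ()
a _ _ ≟ᵥ y = no λ ()
a _ _ ≟ᵥ b _ _ = no λ ()
b _ _ ≟ᵥ x = no λ ()
b _ _ ≟ᵥ y = no λ ()
b _ _ ≟ᵥ a _ _ = no λ ()

open Search _≟ᵥ_

Block : Set
Block = ℕ ⊎ ℕ

block : Block → List (Tri V)
block (inj₁ i) =
  (x , ax , ay) ∷ (y , ax , ay) ∷ (x , ax , a₁) ∷ (x , ax , a₂) ∷ (y , ay , a₁) ∷ (y , ay , a₂) ∷ []
  where
  ax ay a₁ a₂ : V
  ax = a i zero
  ay = a i (suc zero)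
  a₁ = a i (suc (suc zero))
  a₂ = a i (suc (suc (suc zero)))
block (inj₂ j) =
  (x , bx , by) ∷ (y , bx , by) ∷ (b₁ , b₂ , b₃) ∷
  (x , bx , b₁) ∷ (x , bx , b₂) ∷ (x , bx , b₃) ∷ (y , by , b₁) ∷ (y , by , b₂) ∷ (y , by , b₃) ∷ []
  where
  bx by b₁ b₂ b₃ : V
  bx = b j zero
  by = b j (suc zero)
  b₁ = b j (suc (suc zero))
  b₂ = b j (suc (suc (suc zero)))
  b₃ = b j (suc (suc (suc (suc zero))))

Gᵥ : List Block → List (Tri V)
Gᵥ = concatMap block

blocks : ℕ → ℕ → List Block
blocks p q = map inj₁ (upTo p) ++ map inj₂ (upTo q)

blocksOf : V → List Block
blocksOf x = []
blocksOf y = []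
blocksOf (a i _) = inj₁ i ∷ []
blocksOf (b j _) = inj₂ j ∷ []

InBlocks : List Block → V → Set
InBlocks T v = All (_∈ T) (blocksOf v)

InBlock : Block → V → Set
InBlock β v = All (_≡ β) (blocksOf v)

blockVertices : Block → List V
blockVertices (inj₁ i) = map (a i) (allFin 4)
blockVertices (inj₂ j) = map (b j) (allFin 5)

verticesOf : List Block → List V
verticesOf T = x ∷ y ∷ concatMap blockVertices T

pattern through-x-or-y = [] ∷ (refl ∷ []) ∷ (refl ∷ []) ∷ []

block-vertices : ∀ β → All (All (InBlock β) ∘ el) (block β)
block-vertices (inj₁ i) =
  through-x-or-y ∷ through-x-or-y ∷ through-x-or-y ∷ through-x-or-y ∷ through-x-or-y ∷ through-x-or-y ∷ []
block-vertices (inj₂ j) =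
  through-x-or-y ∷ through-x-or-y ∷ ((refl ∷ []) ∷ (refl ∷ []) ∷ (refl ∷ []) ∷ []) ∷
  through-x-or-y ∷ through-x-or-y ∷ through-x-or-y ∷ through-x-or-y ∷ through-x-or-y ∷ through-x-or-y ∷ []

block-middle-vertices : ∀ β → All (λ e → blocksOf (proj₁ (proj₂ e)) ≡ β ∷ []) (block β)
block-middle-vertices (inj₁ i) = refl ∷ refl ∷ refl ∷ refl ∷ refl ∷ refl ∷ []
block-middle-vertices (inj₂ j) = refl ∷ refl ∷ refl ∷ refl ∷ refl ∷ refl ∷ refl ∷ refl ∷ refl ∷ []

Gᵥ-vertices : ∀ {T e} → e ∈ Gᵥ T → All (InBlocks T) (el e)
Gᵥ-vertices e∈ with β , β∈T , e∈β ← find (∈-concatMap⁻ block e∈) =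
  All.map (All.map λ { refl → β∈T }) (All.lookup (block-vertices β) e∈β)

InBlocks⇒∈verticesOf : ∀ {T v} → InBlocks T v → v ∈ verticesOf T
InBlocks⇒∈verticesOf {v = x} [] = here refl
InBlocks⇒∈verticesOf {v = y} [] = there (here refl)
InBlocks⇒∈verticesOf {v = a i k} (i∈T ∷ []) =
  there (there (∈-concatMap⁺ blockVertices (lose i∈T (∈-map⁺ (a i) (∈-allFin k)))))
InBlocks⇒∈verticesOf {v = b j k} (j∈T ∷ []) =
  there (there (∈-concatMap⁺ blockVertices (lose j∈T (∈-map⁺ (b j) (∈-allFin k)))))

InBlocks⇒⊆ : ∀ {T vs} → All (InBlocks T) vs → concatMap blocksOf vs ⊆ T
InBlocks⇒⊆ vs∈T = All.lookup (Allₚ.concat⁺ (Allₚ.map⁺ vs∈T))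

⊆⇒InBlocks : ∀ {T} vs → concatMap blocksOf vs ⊆ T → All (InBlocks T) vs
⊆⇒InBlocks vs S⊆T = Allₚ.map⁻ (Allₚ.concat⁻ (All.tabulate S⊆T))

length-blocksOf : ∀ v → length (blocksOf v) ≤ 1
length-blocksOf x = z≤n
length-blocksOf y = z≤n
length-blocksOf (a _ _) = s≤s z≤n
length-blocksOf (b _ _) = s≤s z≤n

∈-blocks⁺ˡ : ∀ {p q i} → i < p → inj₁ i ∈ blocks p q
∈-blocks⁺ˡ i<p = ∈-++⁺ˡ (∈-map⁺ inj₁ (∈-upTo⁺ i<p))

∈-blocks⁺ʳ : ∀ {p q j} → j < q → inj₂ j ∈ blocks p q
∈-blocks⁺ʳ {p} j<q = ∈-++⁺ʳ (map inj₁ (upTo p)) (∈-map⁺ inj₂ (∈-upTo⁺ j<q))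

∈-blocks⁻ˡ : ∀ {p q i} → inj₁ i ∈ blocks p q → i < p
∈-blocks⁻ˡ {p} i∈ with ∈-++⁻ (map inj₁ (upTo p)) i∈
... | inj₁ i∈ˡ with _ , i′∈ , refl ← ∈-map⁻ inj₁ i∈ˡ = ∈-upTo⁻ i′∈
... | inj₂ i∈ʳ with _ , _ , () ← ∈-map⁻ inj₂ i∈ʳ

∈-blocks⁻ʳ : ∀ {p q j} → inj₂ j ∈ blocks p q → j < q
∈-blocks⁻ʳ {p} j∈ with ∈-++⁻ (map inj₁ (upTo p)) j∈
... | inj₁ j∈ˡ with _ , _ , () ← ∈-map⁻ inj₁ j∈ˡ
... | inj₂ j∈ʳ with _ , j′∈ , refl ← ∈-map⁻ inj₂ j∈ʳ = ∈-upTo⁻ j′∈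

blocks-unique : ∀ p q → Unique (blocks p q)
blocks-unique p q = Unique.++⁺ (Unique.map⁺ Sum.inj₁-injective (Unique.upTo⁺ p))
                               (Unique.map⁺ Sum.inj₂-injective (Unique.upTo⁺ q)) disjoint
  where
  disjoint : ∀ {β} → β ∈ map inj₁ (upTo p) × β ∈ map inj₂ (upTo q) → ⊥
  disjoint (β∈ˡ , β∈ʳ) with _ , _ , refl ← ∈-map⁻ inj₁ β∈ˡ with _ , _ , () ← ∈-map⁻ inj₂ β∈ʳ

length-blocks : ∀ p q → length (blocks p q) ≡ p + q
length-blocks p q = trans (length-++ (map inj₁ (upTo p)))
  (cong₂ _+_ (trans (length-map inj₁ (upTo p)) (length-upTo p)) (trans (length-map inj₂ (upTo q)) (length-upTo q)))

relabel : (ℕ → ℕ) → (ℕ → ℕ) → V → V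
relabel f g x = x
relabel f g y = y
relabel f g (a i k) = a (f i) k
relabel f g (b j k) = b (g j) k

map-relabel-block : ∀ f g β → map (map₃ (relabel f g)) (block β) ≡ block (Sum.map f g β)
map-relabel-block f g (inj₁ i) = refl
map-relabel-block f g (inj₂ j) = refl

map-relabel-Gᵥ : ∀ f g T → map (map₃ (relabel f g)) (Gᵥ T) ≡ Gᵥ (map (Sum.map f g) T)
map-relabel-Gᵥ f g T = begin
  map (map₃ (relabel f g)) (concatMap block T)  ≡⟨ map-concatMap (map₃ (relabel f g)) block T ⟩
  concatMap (map (map₃ (relabel f g)) ∘ block) T ≡⟨ concatMap-cong (map-relabel-block f g) T ⟩
  concatMap (block ∘ Sum.map f g) T              ≡⟨ concatMap-map block (Sum.map f g) T ⟨
  concatMap block (map (Sum.map f g) T)          ∎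
  where open ≡-Reasoning

relabel-inverse : ∀ {f g f′ g′} {P : Block → Set} → (∀ {β} → P β → Sum.map f′ g′ (Sum.map f g β) ≡ β) →
                  ∀ {v} → All P (blocksOf v) → relabel f′ g′ (relabel f g v) ≡ v
relabel-inverse _ {x} [] = refl
relabel-inverse _ {y} [] = refl
relabel-inverse inverse {a i k} (Pβ ∷ []) = cong (λ i′ → a i′ k) (Sum.inj₁-injective (inverse Pβ))
relabel-inverse inverse {b j k} (Pβ ∷ []) = cong (λ j′ → b j′ k) (Sum.inj₂-injective (inverse Pβ))

InBlocks-relabel : ∀ {f g T T′} → (∀ {β} → β ∈ T → Sum.map f g β ∈ T′) →
                   ∀ {v} → InBlocks T v → InBlocks T′ (relabel f g v)
InBlocks-relabel _ {x} [] = []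
InBlocks-relabel _ {y} [] = []
InBlocks-relabel T→T′ {a i k} (i∈T ∷ []) = T→T′ i∈T ∷ []
InBlocks-relabel T→T′ {b j k} (j∈T ∷ []) = T→T′ j∈T ∷ []

-- Reduction to three blocks

model-c3Search : ∀ p q → p + q ≡ 3 → c3Search (Gᵥ (blocks p q)) ≡ false
model-c3Search 0 _ refl = refl
model-c3Search 1 _ refl = refl
model-c3Search 2 _ refl = refl
model-c3Search 3 _ refl = refl

model-saturationCheck : ∀ p q → p + q ≡ 3 → saturationCheck (verticesOf (blocks p q)) (Gᵥ (blocks p q)) ≡ true
model-saturationCheck 0 _ refl = refl
model-saturationCheck 1 _ refl = refl
model-saturationCheck 2 _ refl = refl
model-saturationCheck 3 _ refl = refl

model-C3-free : ∀ {p q} → p + q ≡ 3 → ¬ HasC3 (Gᵥ (blocks p q))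
model-C3-free {p} {q} p+q≡3 c3 = subst T (model-c3Search p q p+q≡3) (c3Search-complete c3)

model-saturated : ∀ {p q} → p + q ≡ 3 → SaturatedOn (InBlocks (blocks p q)) (Gᵥ (blocks p q))
model-saturated {p} {q} p+q≡3 d t⊆blocks =
  saturationCheck-sound (T-≡ .from (model-saturationCheck p q p+q≡3)) d (All.map InBlocks⇒∈verticesOf t⊆blocks)

-- A duplicate-free list T of blocks is isomorphic to blocks nA nB: the k-th A-block of T becomes
-- A-block k, and likewise for B.
module Standardise {T : List Block} (!T : Unique T) where

  private
    is js : List ℕ
    is = lefts T
    js = rights T

  nA nB : ℕ
  nA = length is
  nB = length js

  model : List Block
  model = blocks nA nB

  toModel fromModel : V → V
  toModel = relabel (position is) (position js)
  fromModel = relabel (nth is) (nth js)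

  toModel-∈ : ∀ {β} → β ∈ T → Sum.map (position is) (position js) β ∈ model
  toModel-∈ {inj₁ i} i∈T = ∈-blocks⁺ˡ (position< (∈-lefts⁺ i∈T))
  toModel-∈ {inj₂ j} j∈T = ∈-blocks⁺ʳ (position< (∈-rights⁺ j∈T))

  fromModel-∈ : ∀ {β} → β ∈ model → Sum.map (nth is) (nth js) β ∈ T
  fromModel-∈ {inj₁ s} s∈ = ∈-lefts⁻ (∈-nth (∈-blocks⁻ˡ s∈))
  fromModel-∈ {inj₂ s} s∈ = ∈-rights⁻ (∈-nth (∈-blocks⁻ʳ s∈))

  from∘toᵇ : ∀ {β} → β ∈ T → Sum.map (nth is) (nth js) (Sum.map (position is) (position js) β) ≡ β
  from∘toᵇ {inj₁ i} i∈T = cong inj₁ (nth-position (∈-lefts⁺ i∈T))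
  from∘toᵇ {inj₂ j} j∈T = cong inj₂ (nth-position (∈-rights⁺ j∈T))

  to∘fromᵇ : ∀ {β} → β ∈ model → Sum.map (position is) (position js) (Sum.map (nth is) (nth js) β) ≡ β
  to∘fromᵇ {inj₁ s} s∈ = cong inj₁ (position-nth (lefts-unique !T) (∈-blocks⁻ˡ s∈))
  to∘fromᵇ {inj₂ s} s∈ = cong inj₂ (position-nth (rights-unique !T) (∈-blocks⁻ʳ s∈))

  from∘to : LeftInverseOn (InBlocks T) toModel fromModel
  from∘to = relabel-inverse from∘toᵇ

  to∘from : LeftInverseOn (InBlocks model) fromModel toModel
  to∘from = relabel-inverse to∘fromᵇ

  T⊆fromModel[model] : T ⊆ map (Sum.map (nth is) (nth js)) model
  T⊆fromModel[model] β∈T = subst (_∈ _) (from∘toᵇ β∈T) (∈-map⁺ _ (toModel-∈ β∈T))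

  fromModel[model]⊆T : map (Sum.map (nth is) (nth js)) model ⊆ T
  fromModel[model]⊆T β∈ with _ , β₀∈ , refl ← ∈-map⁻ (Sum.map (nth is) (nth js)) β∈ = fromModel-∈ β₀∈

  fromModel-edges : ∀ {e} → e ∈ Gᵥ model → map₃ fromModel e ∈ Gᵥ T
  fromModel-edges {e} e∈ =
    concatMap⁺ block fromModel[model]⊆T
      (subst (map₃ fromModel e ∈_) (map-relabel-Gᵥ (nth is) (nth js) model) (∈-map⁺ (map₃ fromModel) e∈))

  edges-fromModel : ∀ {e} → e ∈ Gᵥ T → ∃[ e₀ ] e₀ ∈ Gᵥ model × map₃ fromModel e₀ ≡ e
  edges-fromModel {e} e∈ with e₀ , e₀∈ , refl ←
    ∈-map⁻ (map₃ fromModel) (subst (e ∈_) (sym (map-relabel-Gᵥ (nth is) (nth js) model))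
                                         (concatMap⁺ block T⊆fromModel[model] e∈)) = e₀ , e₀∈ , refl

  size : length T ≡ 3 → nA + nB ≡ 3
  size = trans (length-lefts+rights T)

module _ {T : List Block} (!T : Unique T) (|T|≡3 : length T ≡ 3) where
  open Standardise !T

  three-blocks-C3-free : ¬ HasC3 (Gᵥ T)
  three-blocks-C3-free =
    model-C3-free {nA} {nB} (size |T|≡3) ∘ HasC3-pull fromModel toModel to∘from Gᵥ-vertices edges-fromModel

  three-blocks-saturated : SaturatedOn (InBlocks T) (Gᵥ T)
  three-blocks-saturated =
    SaturatedOn-transfer fromModel toModel to∘from from∘to (InBlocks-relabel toModel-∈) Gᵥ-vertices fromModel-edges
      (model-saturated {nA} {nB} (size |T|≡3))

three-blocks-containing : ∀ {p q S} → 3 ≤ p + q → S ⊆ blocks p q → length S ≤ 3 →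
                          ∃[ T ] Unique T × S ⊆ T × T ⊆ blocks p q × length T ≡ 3
three-blocks-containing {p} {q} 3≤p+q S⊆U |S|≤3 =
  extend-to-size (Sum.≡-dec ℕ._≟_ ℕ._≟_) 3 (blocks-unique p q) S⊆U |S|≤3
                 (subst (3 ≤_) (sym (length-blocks p q)) 3≤p+q)

Gᵥ-C3-free : ∀ {p q} → 3 ≤ p + q → ¬ HasC3 (Gᵥ (blocks p q))
Gᵥ-C3-free {p} {q} 3≤p+q c3
  with E , E⊆G , |E|≡3 , c3E ← HasC3-edges c3
  with S , S⊆U , |S|≡|E| , E⊆G[S] ← concatMap-sources block E⊆G
  with T , !T , S⊆T , _ , |T|≡3 ← three-blocks-containing {p} {q} 3≤p+q S⊆U (ℕ.≤-reflexive (trans |S|≡|E| |E|≡3)) =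
  three-blocks-C3-free !T |T|≡3 (HasC3-⊆ (concatMap⁺ block S⊆T ∘ E⊆G[S]) c3E)

Gᵥ-saturated : ∀ {p q} → 3 ≤ p + q → SaturatedOn (InBlocks (blocks p q)) (Gᵥ (blocks p q))
Gᵥ-saturated {p} {q} 3≤p+q {t} d t∈U t∉G
  with T , !T , S⊆T , T⊆U , |T|≡3 ←
         three-blocks-containing {p} {q} 3≤p+q (InBlocks⇒⊆ t∈U) (length-concatMap≤ blocksOf length-blocksOf (el t)) =
  HasC3-⊆ (∷⁺ʳ t (concatMap⁺ block T⊆U))
    (three-blocks-saturated !T |T|≡3 d (⊆⇒InBlocks (el t) S⊆T) (t∉G ∘ LiesIn-≼ (⊆⇒≼ (concatMap⁺ block T⊆U))))

Separated : Tri W → Tri W → Set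
Separated e f = Any (_∉ el f) (el e)

Separated⇒≁ : {e f : Tri W} → Separated e f → ¬ (el e ↭ el f)
Separated⇒≁ sep e↭f with _ , v∈e , v∉f ← find sep = v∉f (∈-resp-↭ e↭f v∈e)

Separated-map⁻ : (f : W → W′) {e e′ : Tri W} → Separated (map₃ f e) (map₃ f e′) → Separated e e′
Separated-map⁻ f {e} sep = Any.map (λ fv∉ v∈ → fv∉ (∈-map⁺ f v∈)) (Anyₚ.map⁻ {xs = el e} sep)

separated? : ∀ e f → Dec (Separated e f)
separated? e f = any? (λ v → ¬? (member? _≟ᵥ_ v (el f))) (el e)

distinct? : ∀ t → Dec (Distinct t)
distinct? (u , v , w) = ¬? (u ≟ᵥ v) ×-dec ¬? (u ≟ᵥ w) ×-dec ¬? (v ≟ᵥ w)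

-- Forgetting the index maps every block onto block number 0, where both properties are decided.
forget : V → V
forget = relabel (λ _ → 0) (λ _ → 0)

block-edges-distinct : ∀ β → All Distinct (block β)
block-edges-distinct β =
  All.map (Distinct-map⁻ forget) (Allₚ.map⁻ (subst (All Distinct) (sym (map-relabel-block _ _ β)) (shape β)))
  where
  shape : ∀ β → All Distinct (block (Sum.map (λ _ → 0) (λ _ → 0) β))
  shape (inj₁ _) = from-yes (All.all? distinct? (block (inj₁ 0)))
  shape (inj₂ _) = from-yes (All.all? distinct? (block (inj₂ 0)))

block-edges-separated : ∀ β → AllPairs Separated (block β)
block-edges-separated β =
  AllPairs.map (Separated-map⁻ forget)
    (AllPairsₚ.map⁻ (subst (AllPairs Separated) (sym (map-relabel-block _ _ β)) (shape β)))
  where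
  shape : ∀ β → AllPairs Separated (block (Sum.map (λ _ → 0) (λ _ → 0) β))
  shape (inj₁ _) = from-yes (allPairs? separated? (block (inj₁ 0)))
  shape (inj₂ _) = from-yes (allPairs? separated? (block (inj₂ 0)))

blocks-separated : ∀ {β β′ e f} → β ≢ β′ → e ∈ block β → f ∈ block β′ → Separated e f
blocks-separated {β} {β′} β≢β′ e∈ f∈ = there (here λ v∈f →
  β≢β′ (All.head (subst (All (_≡ β′)) (All.lookup (block-middle-vertices β) e∈)
                                      (All.lookup (All.lookup (block-vertices β′) f∈) v∈f))))

Gᵥ-edges-distinct : ∀ {T e} → e ∈ Gᵥ T → Distinct e
Gᵥ-edges-distinct {T} e∈ with β , _ , e∈β ← find (∈-concatMap⁻ block {T} e∈) = All.lookup (block-edges-distinct β) e∈β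

Gᵥ-separated : ∀ {T} → Unique T → AllPairs Separated (Gᵥ T)
Gᵥ-separated !T = AllPairsₚ.concat⁺
  (Allₚ.map⁺ (All.tabulate λ {β} _ → block-edges-separated β))
  (AllPairsₚ.map⁺ (AllPairs.map (λ β≢β′ → All.tabulate λ e∈ → All.tabulate λ f∈ → blocks-separated β≢β′ e∈ f∈) !T))

-- Numbering the vertices

-- m ⊕ k is m + toℕ k, except that m ⊕ zero is m itself rather than m + 0: this way encode agrees
-- literally with the numbering in blockA and blockB, and G-as-image holds by computation.
infixl 6 _⊕_
_⊕_ : ∀ {d} → ℕ → Fin d → ℕ
m ⊕ zero = m
m ⊕ suc k = m + toℕ (suc k)

⊕-≡ : ∀ {d} m (k : Fin d) → m ⊕ k ≡ m + toℕ k
⊕-≡ m zero = sym (ℕ.+-identityʳ m)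
⊕-≡ m (suc k) = refl

encode : ℕ → V → ℕ
encode p x = 0
encode p y = 1
encode p (a i k) = 2 + 4 * i ⊕ k
encode p (b j k) = 2 + 4 * p + 5 * j ⊕ k

decode : ℕ → ℕ → V
decode p zero = x
decode p (suc zero) = y
decode p (suc (suc w)) with w <? 4 * p
... | yes _ = a (w / 4) (w mod 4)
... | no _ = b ((w ∸ 4 * p) / 5) ((w ∸ 4 * p) mod 5)

G-as-image : ∀ p q →
             concatMap blockA (upTo p) ++ concatMap (blockB p) (upTo q) ≡ map (map₃ (encode p)) (Gᵥ (blocks p q))
G-as-image p q = sym (begin
  map (map₃ (encode p)) (concatMap block (map inj₁ (upTo p) ++ map inj₂ (upTo q)))
    ≡⟨ map-concatMap (map₃ (encode p)) block (map inj₁ (upTo p) ++ map inj₂ (upTo q)) ⟩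
  concatMap encodeBlock (map inj₁ (upTo p) ++ map inj₂ (upTo q))
    ≡⟨ concatMap-++ encodeBlock (map inj₁ (upTo p)) (map inj₂ (upTo q)) ⟩
  concatMap encodeBlock (map inj₁ (upTo p)) ++ concatMap encodeBlock (map inj₂ (upTo q))
    ≡⟨ cong₂ _++_ (concatMap-map encodeBlock inj₁ (upTo p)) (concatMap-map encodeBlock inj₂ (upTo q)) ⟩
  concatMap blockA (upTo p) ++ concatMap (blockB p) (upTo q) ∎)
  where
  open ≡-Reasoning
  encodeBlock : Block → List Triple
  encodeBlock = map (map₃ (encode p)) ∘ block

divMod-unique : ∀ {d} {r r′ : Fin d} {q q′} → toℕ r + q * d ≡ toℕ r′ + q′ * d → r ≡ r′ × q ≡ q′
divMod-unique {suc d} {r} {r′} {q} {q′} eq = r≡r′ , ℕ.*-cancelʳ-≡ q q′ (suc d) (ℕ.+-cancelˡ-≡ (toℕ r) _ _ eq′)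
  where
  remainder : ∀ (s : Fin (suc d)) k → (toℕ s + k * suc d) % suc d ≡ toℕ s
  remainder s k = trans ([m+kn]%n≡m%n (toℕ s) k (suc d)) (m<n⇒m%n≡m (Fin.toℕ<n s))
  r≡r′ : r ≡ r′
  r≡r′ = Fin.toℕ-injective (trans (sym (remainder r q)) (trans (cong (_% suc d) eq) (remainder r′ q′)))
  eq′ : toℕ r + q * suc d ≡ toℕ r + q′ * suc d
  eq′ = trans eq (cong (λ s → toℕ s + q′ * suc d) (sym r≡r′))

divMod-inverse : ∀ {d} (k : Fin (suc d)) i → (toℕ k + i * suc d) mod suc d ≡ k × (toℕ k + i * suc d) / suc d ≡ i
divMod-inverse {d} k i = divMod-unique (sym (DivMod.property ((toℕ k + i * suc d) divMod suc d)))

block-bound : ∀ d {i n} (k : Fin d) → i < n → toℕ k + i * d < n * d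
block-bound d {i} k i<n = ℕ.<-≤-trans (ℕ.+-monoˡ-< (i * d) (Fin.toℕ<n k)) (ℕ.*-monoˡ-≤ d i<n)

encode-a : ∀ p i k → encode p (a i k) ≡ 2 + (toℕ k + i * 4)
encode-a p i k =
  trans (⊕-≡ (2 + 4 * i) k) (cong (2 +_) (trans (ℕ.+-comm (4 * i) (toℕ k)) (cong (toℕ k +_) (ℕ.*-comm 4 i))))

encode-b : ∀ p j k → encode p (b j k) ≡ 2 + (4 * p + (toℕ k + j * 5))
encode-b p j k = trans (⊕-≡ (2 + 4 * p + 5 * j) k) (cong (2 +_) (begin
  4 * p + 5 * j + toℕ k    ≡⟨ ℕ.+-assoc (4 * p) (5 * j) (toℕ k) ⟩
  4 * p + (5 * j + toℕ k)  ≡⟨ cong (4 * p +_) (ℕ.+-comm (5 * j) (toℕ k)) ⟩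
  4 * p + (toℕ k + 5 * j)  ≡⟨ cong (λ m → 4 * p + (toℕ k + m)) (ℕ.*-comm 5 j) ⟩
  4 * p + (toℕ k + j * 5)  ∎))
  where open ≡-Reasoning

decode-a : ∀ {p w} → w < 4 * p → decode p (2 + w) ≡ a (w / 4) (w mod 4)
decode-a {p} {w} w<4p with w <? 4 * p
... | yes _ = refl
... | no w≮4p = contradiction w<4p w≮4p

decode-b : ∀ {p w} → w ≮ 4 * p → decode p (2 + w) ≡ b ((w ∸ 4 * p) / 5) ((w ∸ 4 * p) mod 5)
decode-b {p} {w} w≮4p with w <? 4 * p
... | yes w<4p = contradiction w<4p w≮4p
... | no _ = refl

encode-bound : ∀ {p q v} → InBlocks (blocks p q) v → encode p v < 2 + 4 * p + 5 * q
encode-bound {v = x} [] = s≤s z≤n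
encode-bound {v = y} [] = s≤s (s≤s z≤n)
encode-bound {p} {q} {a i k} (i∈ ∷ []) rewrite encode-a p i k =
  s≤s (s≤s (ℕ.<-≤-trans (subst (toℕ k + i * 4 <_) (ℕ.*-comm p 4) (block-bound 4 k (∈-blocks⁻ˡ {p} {q} i∈)))
                         (ℕ.m≤m+n (4 * p) (5 * q))))
encode-bound {p} {q} {b j k} (j∈ ∷ []) rewrite encode-b p j k =
  s≤s (s≤s (ℕ.+-monoʳ-< (4 * p) (subst (toℕ k + j * 5 <_) (ℕ.*-comm q 5) (block-bound 5 k (∈-blocks⁻ʳ {p} {q} j∈)))))

decode-encode : ∀ {p q} → LeftInverseOn (InBlocks (blocks p q)) (encode p) (decode p)
decode-encode {v = x} [] = refl
decode-encode {v = y} [] = refl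
decode-encode {p} {q} {a i k} (i∈ ∷ []) with k≡ , i≡ ← divMod-inverse k i =
  trans (cong (decode p) (encode-a p i k)) (trans (decode-a w<4p) (cong₂ a i≡ k≡))
  where
  w<4p : toℕ k + i * 4 < 4 * p
  w<4p = subst (toℕ k + i * 4 <_) (ℕ.*-comm p 4) (block-bound 4 k (∈-blocks⁻ˡ {p} {q} i∈))
decode-encode {p} {q} {b j k} (j∈ ∷ []) with k≡ , j≡ ← divMod-inverse k j =
  trans (cong (decode p) (encode-b p j k))
    (trans (decode-b (ℕ.≤⇒≯ (ℕ.m≤m+n (4 * p) _)))
      (trans (cong (λ u → b (u / 5) (u mod 5)) (ℕ.m+n∸m≡n (4 * p) (toℕ k + j * 5))) (cong₂ b j≡ k≡)))

decode-correct : ∀ {p q w} → w < 2 + 4 * p + 5 * q →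
                 InBlocks (blocks p q) (decode p w) × encode p (decode p w) ≡ w
decode-correct {w = zero} _ = [] , refl
decode-correct {w = suc zero} _ = [] , refl
decode-correct {p} {q} {suc (suc w)} (s≤s (s≤s w<)) with w <? 4 * p
... | yes w<4p =
  ∈-blocks⁺ˡ {p} {q} (m<n*o⇒m/o<n (subst (w <_) (ℕ.*-comm 4 p) w<4p)) ∷ [] ,
  trans (encode-a p (w / 4) (w mod 4)) (cong (2 +_) (sym (DivMod.property (w divMod 4))))
... | no w≮4p =
  ∈-blocks⁺ʳ {p} {q} (m<n*o⇒m/o<n (subst (u <_) (ℕ.*-comm 5 q) u<5q)) ∷ [] ,
  trans (encode-b p (u / 5) (u mod 5))
        (cong (2 +_) (trans (cong (4 * p +_) (sym (DivMod.property (u divMod 5)))) 4p+u≡w))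
  where
  u : ℕ
  u = w ∸ 4 * p
  4p+u≡w : 4 * p + u ≡ w
  4p+u≡w = ℕ.m+[n∸m]≡n (ℕ.≮⇒≥ w≮4p)
  u<5q : u < 5 * q
  u<5q = subst (u <_) (ℕ.m+n∸m≡n (4 * p) (5 * q)) (ℕ.∸-monoˡ-< w< (ℕ.≮⇒≥ w≮4p))

-- The construction on ℕ

LiesIn⇒∈E : ∀ {t : Triple} {H : Hypergraph} → Distinct t → LiesIn t H → t ∈E H
LiesIn⇒∈E d = Any.map (∈-perms⇒↭ ∘ ⊆ₜ⇒∈-perms d)

∈E⇒LiesIn : ∀ {t : Triple} {H : Hypergraph} → t ∈E H → LiesIn t H
∈E⇒LiesIn = Any.map ↭⇒⊆ₜ

HasC3⇒ContainsC3 : ∀ {H : Hypergraph} → HasC3 H → ContainsC3 H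
HasC3⇒ContainsC3 (v₁ , v₂ , v₃ , v₄ , v₅ , v₆ , d , s₁ , s₂ , s₃) with d₁ , d₂ , d₃ ← ≢-sides d =
  v₁ , v₂ , v₃ , v₄ , v₅ , v₆ , d , LiesIn⇒∈E d₁ s₁ , LiesIn⇒∈E d₂ s₂ , LiesIn⇒∈E d₃ s₃

ContainsC3⇒HasC3 : ∀ {H : Hypergraph} → ContainsC3 H → HasC3 H
ContainsC3⇒HasC3 (v₁ , v₂ , v₃ , v₄ , v₅ , v₆ , d , m₁ , m₂ , m₃) =
  v₁ , v₂ , v₃ , v₄ , v₅ , v₆ , d , ∈E⇒LiesIn m₁ , ∈E⇒LiesIn m₂ , ∈E⇒LiesIn m₃

Gₚ : ℕ → ℕ → Hypergraph
Gₚ p q = concatMap blockA (upTo p) ++ concatMap (blockB p) (upTo q)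

Gₚ-saturated : ∀ {p q} → 3 ≤ p + q → Saturated (2 + 4 * p + 5 * q) (Gₚ p q)
Gₚ-saturated {p} {q} 3≤p+q rewrite G-as-image p q = is-hypergraph , C3-free , saturated
  where
  U : List Block
  U = blocks p q
  H : Hypergraph
  H = map (map₃ (encode p)) (Gᵥ U)

  encode-injective : InjectiveOn (InBlocks U) (encode p)
  encode-injective = LeftInverseOn⇒InjectiveOn {g = decode p} (decode-encode {p} {q})

  H-edges : ∀ {e} → e ∈ H → ∃[ e₀ ] e₀ ∈ Gᵥ U × map₃ (encode p) e₀ ≡ e
  H-edges e∈ with e₀ , e₀∈ , refl ← ∈-map⁻ (map₃ (encode p)) e∈ = e₀ , e₀∈ , refl

  decode-↭ : ∀ {e f} → All (InBlocks U) (el e) → All (InBlocks U) (el f) →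
             el (map₃ (encode p) e) ↭ el (map₃ (encode p) f) → el e ↭ el f
  decode-↭ e⊆U f⊆U = subst₂ _↭_ (cong el (map₃-inverse {f = encode p} {g = decode p} (decode-encode {p} {q}) e⊆U))
                                 (cong el (map₃-inverse {f = encode p} {g = decode p} (decode-encode {p} {q}) f⊆U))
                     ∘ ↭-map⁺ (decode p)

  is-hypergraph : IsHypergraph (2 + 4 * p + 5 * q) H
  is-hypergraph =
    Allₚ.map⁺ (All.tabulate λ e∈ → Distinct-map encode-injective (Gᵥ-vertices {U} e∈) (Gᵥ-edges-distinct {U} e∈) ,
                                   All-el-map₃ (encode p) (encode-bound {p} {q}) (Gᵥ-vertices {U} e∈)) ,
    AllPairs-map (map₃ (encode p)) (λ e⊆U f⊆U sep → Separated⇒≁ sep ∘ decode-↭ e⊆U f⊆U)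
                 (All.tabulate (Gᵥ-vertices {U})) (Gᵥ-separated (blocks-unique p q))

  C3-free : ¬ ContainsC3 H
  C3-free =
    Gᵥ-C3-free {p} {q} 3≤p+q ∘ HasC3-pull (encode p) (decode p) (decode-encode {p} {q}) (Gᵥ-vertices {U}) H-edges
                             ∘ ContainsC3⇒HasC3

  saturated : ∀ t → Distinct3 t → All (_< 2 + 4 * p + 5 * q) (elems t) → ¬ t ∈E H → ContainsC3 (t ∷ H)
  saturated t d t<N t∉H = HasC3⇒ContainsC3
    (SaturatedOn-transfer (encode p) (decode p) (decode-encode {p} {q})
      (proj₂ ∘ decode-correct {p} {q}) (proj₁ ∘ decode-correct {p} {q})
      (Gᵥ-vertices {U}) (∈-map⁺ (map₃ (encode p))) (Gᵥ-saturated {p} {q} 3≤p+q) d t<N (t∉H ∘ LiesIn⇒∈E d))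

length-Gₚ : ∀ p q → length (Gₚ p q) ≡ 6 * p + 9 * q
length-Gₚ p q = begin
  length (Gₚ p q)
    ≡⟨ length-++ (concatMap blockA (upTo p)) ⟩
  length (concatMap blockA (upTo p)) + length (concatMap (blockB p) (upTo q))
    ≡⟨ cong₂ _+_ (length-concatMap blockA (λ _ → refl) (upTo p)) (length-concatMap (blockB p) (λ _ → refl) (upTo q)) ⟩
  length (upTo p) * 6 + length (upTo q) * 9
    ≡⟨ cong₂ _+_ (cong (_* 6) (length-upTo p)) (cong (_* 9) (length-upTo q)) ⟩
  p * 6 + q * 9
    ≡⟨ cong₂ _+_ (ℕ.*-comm p 6) (ℕ.*-comm q 9) ⟩
  6 * p + 9 * q ∎
  where open ≡-Reasoning

edge-bound : ∀ p q → q ≤ 3 → 2 * (6 * p + 9 * q) ≤ 3 * (2 + 4 * p + 5 * q) + 3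
edge-bound p q q≤3 =
  subst₂ _≤_ (sym (lhs p q)) (sym (rhs p q)) (ℕ.+-monoʳ-≤ (3 * (4 * p + 5 * q)) (ℕ.*-monoʳ-≤ 3 q≤3))
  where
  lhs : ∀ p q → 2 * (6 * p + 9 * q) ≡ 3 * (4 * p + 5 * q) + 3 * q
  lhs = solve-∀
  rhs : ∀ p q → 3 * (2 + 4 * p + 5 * q) + 3 ≡ 3 * (4 * p + 5 * q) + 3 * 3
  rhs = solve-∀

decomposition : ∀ n → 14 ≤ n → n ≡ 2 + 4 * pOf n + 5 * qOf n × 3 ≤ pOf n + qOf n × qOf n ≤ 3
decomposition n 14≤n = n≡ , subst (3 ≤_) (sym p+q≡m) 3≤m , ℕ.≤-pred r<4
  where
  M m r : ℕ
  M = n ∸ 2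
  m = M / 4
  r = M % 4
  r<4 : r < 4
  r<4 = m%n<n M 4
  M≡ : M ≡ r + m * 4
  M≡ = m≡m%n+[m/n]*n M 4
  3≤m : 3 ≤ m
  3≤m = ℕ.≮⇒≥ λ m<3 → ℕ.<⇒≱ (ℕ.+-mono-<-≤ r<4 (ℕ.*-monoˡ-≤ 4 (ℕ.≤-pred m<3))) (subst (12 ≤_) M≡ (ℕ.∸-monoˡ-≤ 2 14≤n))
  r≤m : r ≤ m
  r≤m = ℕ.≤-trans (ℕ.≤-pred r<4) 3≤m
  p≡ : pOf n ≡ m ∸ r
  p≡ = cong (_∸ (2 + r)) (ℕ.+-comm m 2)
  p+q≡m : pOf n + qOf n ≡ m
  p+q≡m = trans (cong (_+ r) p≡) (ℕ.m∸n+n≡m r≤m)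
  regroup : ∀ d r → 2 + (r + (d + r) * 4) ≡ 2 + 4 * d + 5 * r
  regroup = solve-∀
  n≡ : n ≡ 2 + 4 * pOf n + 5 * qOf n
  n≡ = begin
    n                          ≡⟨ ℕ.m+[n∸m]≡n (ℕ.≤-trans (s≤s (s≤s z≤n)) 14≤n) ⟨
    2 + M                      ≡⟨ cong (2 +_) M≡ ⟩
    2 + (r + m * 4)            ≡⟨ cong (λ k → 2 + (r + k * 4)) (ℕ.m∸n+n≡m r≤m) ⟨
    2 + (r + (m ∸ r + r) * 4)  ≡⟨ regroup (m ∸ r) r ⟩
    2 + 4 * (m ∸ r) + 5 * r    ≡⟨ cong (λ k → 2 + 4 * k + 5 * r) p≡ ⟨
    2 + 4 * pOf n + 5 * qOf n  ∎
    where open ≡-Reasoning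

theorem2p2 : ((n : ℕ) → 14 ≤ n → Saturated n (G n))
           × (∃[ C ] ∃[ N ] ((n : ℕ) → N ≤ n → ∃[ k ] (SatAtMost n k × 2 * k ≤ 3 * n + C)))
theorem2p2 = G-saturated , 3 , 14 , λ n 14≤n → length (G n) , (G n , G-saturated n 14≤n , ℕ.≤-refl) , G-size n 14≤n
  where
  G-saturated : ∀ n → 14 ≤ n → Saturated n (G n)
  G-saturated n 14≤n with n≡ , 3≤p+q , _ ← decomposition n 14≤n =
    subst (λ m → Saturated m (G n)) (sym n≡) (Gₚ-saturated {pOf n} {qOf n} 3≤p+q)
  G-size : ∀ n → 14 ≤ n → 2 * length (G n) ≤ 3 * n + 3
  G-size n 14≤n with n≡ , _ , q≤3 ← decomposition n 14≤n =
    subst₂ (λ k m → 2 * k ≤ 3 * m + 3) (sym (length-Gₚ (pOf n) (qOf n))) (sym n≡) (edge-bound (pOf n) (qOf n) q≤3)
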